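{- Let $n\ge1$, $x,y$ coprime with $1\le x<y$, and consider the rotor multigraph $P^{x,y}_n$. There is a bijection $\psi$ from the set of acyclic rotor configurations of $P^{x,y}_n$ onto $L^n_a$ such that $g(\rho)=h_E(\psi(\rho))$ for every acyclic rotor configuration $\rho$.
   Context: $P^{x,y}_n$ has vertices $u_0,\dots,u_{n+1}$; $u_0,u_{n+1}$ are sinks and $V_0=\{u_1,\dots,u_n\}$. For $1\le k\le n$, $u_k$ has outgoing arcs $a^k_0,\dots,a^k_{x+y-1}$, with $a^k_i$ going to $u_{k+1}$ for $0\le i\le x-1$ and to $u_{k-1}$ for $x\le i\le x+y-1$. A rotor configuration assigns to each $u\in V_0$ an outgoing arc $\rho(u)$; it is acyclic if the graph with all vertices and arc set $\{\rho(u):u\in V_0\}$ has no directed cycle. With $h(u_0)=0$, $h(u_k)=\sum_{i=0}^{k-1}x^{n-i}y^i$, define $g(a^k_j)=\sum_{i=0}^{j-1}\big(h(\mathrm{head}(a^k_i))-h(u_k)\big)$ and $g(\rho)=\sum_{u\in V_0}g(\rho(u))$. Let $d_k=x^{n-k}y^k$ for $0\le k\le n+1$, and for a word $c=(c_0,\dots,c_{n+1})\in\mathbb{Z}^{n+2}$ let $h_E(c)=\sum_{k=0}^{n+1}c_kd_k$. $L_a$ is the language over the alphabet $\mathbb{Z}$ described by the regular expression $\{1,\dots,y\}^*\cdot0\cdot\{0,\dots,x-1\}^*\cdot0$ (a set denotes any single letter from it), and $L^n_a$ is the set of words of $L_a$ of length $n+2$. -}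

module Defs where

open import Data.Nat as ℕ using (ℕ; zero; suc; _∸_; _^_; _<?_)
open import Data.Integer as ℤ using (ℤ; +_; 0ℤ)
open import Data.Fin using (Fin; toℕ; fromℕ<)
open import Data.Vec using (Vec; lookup)
open import Data.List using (List; []; _∷_)
open import Data.Maybe using (Maybe; just; nothing; _>>=_)
open import Data.Product using (∃; _×_)
open import Relation.Binary.PropositionalEquality using (_≡_)
open import Relation.Nullary using (¬_; yes; no)

Σℕ< : ℕ → (ℕ → ℕ) → ℕ
Σℕ< zero    f = 0
Σℕ< (suc m) f = Σℕ< m f ℕ.+ f m

Σℤ< : ℕ → (ℕ → ℤ) → ℤ
Σℤ< zero    f = 0ℤ
Σℤ< (suc m) f = Σℤ< m f ℤ.+ f m

Σℤᶠ : ∀ {m} → (Fin m → ℤ) → ℤ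
Σℤᶠ {zero}  f = 0ℤ
Σℤᶠ {suc m} f = f Fin.zero ℤ.+ Σℤᶠ (λ i → f (Fin.suc i))

-- Rotor configuration of P^{x,y}_n: entry k (k : Fin n) is the index j of the
-- arc a^{k+1}_j chosen at vertex u_{k+1}.  Vertices u_0..u_{n+1} are indexed by ℕ.
record Config (n x y : ℕ) : Set where
  constructor mkConfig
  field rot : Vec (Fin (x ℕ.+ y)) n
open Config public

headArc : ℕ → ℕ → ℕ → ℕ
headArc x k i with i <? x
... | yes _ = suc k
... | no  _ = k ∸ 1

step : ∀ {n x y} → Config n x y → ℕ → Maybe ℕ
step {n} {x} ρ zero = nothing
step {n} {x} ρ (suc k) with k <? n
... | yes p = just (headArc x (suc k) (toℕ (lookup (rot ρ) (fromℕ< p))))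
... | no  _ = nothing

iter : ∀ {n x y} → Config n x y → ℕ → ℕ → Maybe ℕ
iter ρ zero    v = just v
iter ρ (suc m) v = step ρ v >>= iter ρ m

HasCycle : ∀ {n x y} → Config n x y → Set
HasCycle ρ = ∃ λ v → ∃ λ m → iter ρ (suc m) v ≡ just v

Acyclic : ∀ {n x y} → Config n x y → Set
Acyclic ρ = ¬ HasCycle ρ

hV : ℕ → ℕ → ℕ → ℕ → ℕ
hV n x y k = Σℕ< k (λ i → x ^ (n ∸ i) ℕ.* y ^ i)

gArc : ℕ → ℕ → ℕ → ℕ → ℕ → ℤ
gArc n x y k j = Σℤ< j (λ i → + hV n x y (headArc x k i) ℤ.- + hV n x y k)

gConf : ∀ {n x y} → Config n x y → ℤ
gConf {n} {x} {y} ρ = Σℤᶠ (λ k → gArc n x y (suc (toℕ k)) (toℕ (lookup (rot ρ) k)))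

-- d_k = x^{n-k} y^k (truncated subtraction; only matters for k = n+1, where
-- every word of L^n_a has c_{n+1} = 0)
dE : ℕ → ℕ → ℕ → ℕ → ℕ
dE n x y k = x ^ (n ∸ k) ℕ.* y ^ k

hE : ∀ {n} → ℕ → ℕ → Vec ℤ (n ℕ.+ 2) → ℤ
hE {n} x y c = Σℤᶠ (λ k → lookup c k ℤ.* + dE n x y (toℕ k))

data Tail (x : ℕ) : List ℤ → Set where
  end : Tail x (0ℤ ∷ [])
  dig : ∀ {c cs} → 0ℤ ℤ.≤ c → c ℤ.< + x → Tail x cs → Tail x (c ∷ cs)

data La (x y : ℕ) : List ℤ → Set where
  start : ∀ {cs} → Tail x cs → La x y (0ℤ ∷ cs)
  pos   : ∀ {c cs} → + 1 ℤ.≤ c → c ℤ.≤ + y → La x y cs → La x y (c ∷ cs)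

{-# OPTIONS --safe #-}
module Submission where

-- In P^{x,y}_n a rotor configuration can only close a cycle u_k → u_{k+1} → u_k, so
-- ρ is acyclic iff, for some s, the rotors of u_1,…,u_s point down and those of
-- u_{s+1},…,u_n point up.  Record the rotor a^k_j as the letter x+y−j ∈ [1,y] at
-- position k−1 if it points down and as the letter j ∈ [0,x) at position k if it
-- points up: this maps these configurations bijectively onto L^n_a.  Since
-- h(u_{k+1}) − h(u_k) = d_k and x d_k = y d_{k−1}, g(a^k_j) is j d_k for an upward
-- and (x+y−j) d_{k−1} for a downward arc, i.e. the weight of the recorded letter.

open import Defs
open import Data.Nat using (ℕ; zero; suc; _+_; _*_; _∸_; _^_; _≤_; _<_; _<?_; _≤?_; z≤n; s≤s)
import Data.Nat.Properties as ℕₚ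
import Data.Nat.Tactic.RingSolver as ℕ-Solver
open import Data.Nat.Coprimality using (Coprime)
open import Data.Integer as ℤ using (ℤ; +_; 0ℤ; +≤+; +<+)
import Data.Integer.Properties as ℤₚ
import Data.Integer.Tactic.RingSolver as ℤ-Solver
open import Data.Fin as Fin using (Fin; toℕ; fromℕ<)
import Data.Fin.Properties as Finₚ
open import Data.Vec using (Vec; []; _∷_; lookup; toList)
import Data.Vec.Properties as VP
open import Data.Vec.Relation.Unary.All using (All; []; _∷_)
import Data.Vec.Relation.Unary.All.Properties as Allₚ
open import Data.Maybe using (just)
open import Data.Maybe.Properties using (just-injective)
open import Data.Product using (Σ-syntax; ∃-syntax; _×_; _,_; proj₂)
open import Data.Empty using (⊥-elim)
open import Function using (_∘_)
open import Relation.Nullary using (yes; no; ¬_)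
open import Relation.Nullary.Decidable using (dec-yes; dec-no)
open import Relation.Binary.PropositionalEquality
  using (_≡_; refl; sym; trans; cong; cong₂; subst; module ≡-Reasoning)

Σℤᶠ-cong : ∀ {m} {f g : Fin m → ℤ} → (∀ k → f k ≡ g k) → Σℤᶠ f ≡ Σℤᶠ g
Σℤᶠ-cong {zero}  f≗g = refl
Σℤᶠ-cong {suc m} f≗g = cong₂ ℤ._+_ (f≗g Fin.zero) (Σℤᶠ-cong (λ k → f≗g (Fin.suc k)))

sumFrom : ∀ {A : Set} {m} → (ℕ → A → ℤ) → ℕ → Vec A m → ℤ
sumFrom f o []       = 0ℤ
sumFrom f o (a ∷ as) = f o a ℤ.+ sumFrom f (suc o) as

Σℤᶠ-lookup : ∀ {A : Set} {m} (f : ℕ → A → ℤ) o (v : Vec A m) →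
             Σℤᶠ (λ k → f (o + toℕ k) (lookup v k)) ≡ sumFrom f o v
Σℤᶠ-lookup f o []       = refl
Σℤᶠ-lookup f o (a ∷ as) = cong₂ ℤ._+_
  (cong (λ i → f i a) (ℕₚ.+-identityʳ o))
  (trans (Σℤᶠ-cong (λ k → cong (λ i → f i (lookup as k)) (ℕₚ.+-suc o (toℕ k))))
         (Σℤᶠ-lookup f (suc o) as))

[i+j]-i≡j : ∀ i j → (i ℤ.+ j) ℤ.- i ≡ j
[i+j]-i≡j = ℤ-Solver.solve-∀

x*d[1+k]≡y*d[k] : ∀ n x y {k} → k < n → x * dE n x y (suc k) ≡ y * dE n x y k
x*d[1+k]≡y*d[k] n x y {k} k<n = begin
  x * (x ^ (n ∸ suc k) * (y * y ^ k))  ≡⟨ swap x y (x ^ (n ∸ suc k)) (y ^ k) ⟩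
  y * (x ^ suc (n ∸ suc k) * y ^ k)    ≡⟨ cong (λ e → y * (x ^ e * y ^ k)) (sym (ℕₚ.+-∸-assoc 1 k<n)) ⟩
  y * (x ^ (n ∸ k) * y ^ k)            ∎
  where
    open ≡-Reasoning
    swap : ∀ x y a b → x * (a * (y * b)) ≡ y * ((x * a) * b)
    swap = ℕ-Solver.solve-∀

module PathRotors (n x y : ℕ) where

  d : ℕ → ℕ
  d = dE n x y

  headArc-forward : ∀ k {j} → j < x → headArc x k j ≡ suc k
  headArc-forward k {j} j<x rewrite proj₂ (dec-yes (j <? x) j<x) = refl

  headArc-backward : ∀ k {j} → x ≤ j → headArc x k j ≡ k ∸ 1
  headArc-backward k {j} x≤j rewrite dec-no (j <? x) (ℕₚ.≤⇒≯ x≤j) = refl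

  forwardDigit : ℕ → ℕ
  forwardDigit j with j <? x
  ... | yes _ = j
  ... | no  _ = 0

  backwardDigit : ℕ → ℕ
  backwardDigit j with j <? x
  ... | yes _ = 0
  ... | no  _ = (x + y) ∸ j

  module _ {j} (j<x : j < x) where
    forwardDigit-forward : forwardDigit j ≡ j
    forwardDigit-forward rewrite proj₂ (dec-yes (j <? x) j<x) = refl

    backwardDigit-forward : backwardDigit j ≡ 0
    backwardDigit-forward rewrite proj₂ (dec-yes (j <? x) j<x) = refl

  module _ {j} (x≤j : x ≤ j) where
    forwardDigit-backward : forwardDigit j ≡ 0
    forwardDigit-backward rewrite dec-no (j <? x) (ℕₚ.≤⇒≯ x≤j) = refl

    backwardDigit-backward : backwardDigit j ≡ (x + y) ∸ j
    backwardDigit-backward rewrite dec-no (j <? x) (ℕₚ.≤⇒≯ x≤j) = refl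

  increment : ℕ → ℕ → ℤ
  increment k i = + hV n x y (headArc x k i) ℤ.- + hV n x y k

  increment-forward : ∀ o {i} → i < x → increment (suc o) i ≡ + d (suc o)
  increment-forward o i<x rewrite headArc-forward (suc o) i<x =
    [i+j]-i≡j (+ hV n x y (suc o)) (+ d (suc o))

  increment-backward : ∀ o {i} → x ≤ i → increment (suc o) i ≡ ℤ.- + d o
  increment-backward o x≤i rewrite headArc-backward (suc o) x≤i =
    i-[i+j]≡-j (+ hV n x y o) (+ d o)
    where
      i-[i+j]≡-j : ∀ i j → i ℤ.- (i ℤ.+ j) ≡ ℤ.- j
      i-[i+j]≡-j = ℤ-Solver.solve-∀

  gArc-forward : ∀ o {j} → j ≤ x → gArc n x y (suc o) j ≡ + (j * d (suc o))
  gArc-forward o {zero}  _   = refl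
  gArc-forward o {suc j} j<x = begin
    gArc n x y (suc o) j ℤ.+ increment (suc o) j
      ≡⟨ cong₂ ℤ._+_ (gArc-forward o (ℕₚ.<⇒≤ j<x)) (increment-forward o j<x) ⟩
    + (j * d (suc o) + d (suc o))
      ≡⟨ cong +_ (ℕₚ.+-comm (j * d (suc o)) (d (suc o))) ⟩
    + (suc j * d (suc o)) ∎
    where open ≡-Reasoning

  gArc-beyondForward : ∀ o t → gArc n x y (suc o) (x + t) ≡ + (x * d (suc o)) ℤ.- + (t * d o)
  gArc-beyondForward o zero rewrite ℕₚ.+-identityʳ x =
    trans (gArc-forward o ℕₚ.≤-refl) (sym (ℤₚ.+-identityʳ _))
  gArc-beyondForward o (suc t) rewrite ℕₚ.+-suc x t = begin
    gArc n x y (suc o) (x + t) ℤ.+ increment (suc o) (x + t)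
      ≡⟨ cong₂ ℤ._+_ (gArc-beyondForward o t) (increment-backward o (ℕₚ.m≤m+n x t)) ⟩
    (+ (x * d (suc o)) ℤ.- + (t * d o)) ℤ.- + d o
      ≡⟨ [i-j]-k≡i-[k+j] (+ (x * d (suc o))) (+ (t * d o)) (+ d o) ⟩
    + (x * d (suc o)) ℤ.- + (suc t * d o) ∎
    where
      open ≡-Reasoning
      [i-j]-k≡i-[k+j] : ∀ i j k → (i ℤ.- j) ℤ.- k ≡ i ℤ.- (k ℤ.+ j)
      [i-j]-k≡i-[k+j] = ℤ-Solver.solve-∀

  gArc-backward : ∀ o {t} → o < n → t ≤ y → gArc n x y (suc o) (x + t) ≡ + ((y ∸ t) * d o)
  gArc-backward o {t} o<n t≤y = begin
    gArc n x y (suc o) (x + t)                       ≡⟨ gArc-beyondForward o t ⟩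
    + (x * d (suc o)) ℤ.- + (t * d o)                ≡⟨ cong (λ e → + e ℤ.- + (t * d o)) x*d[1+o]≡t*d[o]+[y∸t]*d[o] ⟩
    + (t * d o + (y ∸ t) * d o) ℤ.- + (t * d o)      ≡⟨ [i+j]-i≡j (+ (t * d o)) (+ ((y ∸ t) * d o)) ⟩
    + ((y ∸ t) * d o)                                ∎
    where
      open ≡-Reasoning
      x*d[1+o]≡t*d[o]+[y∸t]*d[o] : x * d (suc o) ≡ t * d o + (y ∸ t) * d o
      x*d[1+o]≡t*d[o]+[y∸t]*d[o] = begin
        x * d (suc o)              ≡⟨ x*d[1+k]≡y*d[k] n x y o<n ⟩
        y * d o                    ≡⟨ cong (_* d o) (sym (ℕₚ.m+[n∸m]≡n t≤y)) ⟩
        (t + (y ∸ t)) * d o        ≡⟨ ℕₚ.*-distribʳ-+ (d o) t (y ∸ t) ⟩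
        t * d o + (y ∸ t) * d o    ∎

  arcWeight : ℕ → ℕ → ℤ
  arcWeight o j = + backwardDigit j ℤ.* + d o ℤ.+ + forwardDigit j ℤ.* + d (suc o)

  gArc≡arcWeight : ∀ o {j} → o < n → j < x + y → gArc n x y (suc o) j ≡ arcWeight o j
  gArc≡arcWeight o {j} o<n j<x+y with j <? x
  ... | yes j<x = begin
    gArc n x y (suc o) j            ≡⟨ gArc-forward o (ℕₚ.<⇒≤ j<x) ⟩
    + (j * d (suc o))               ≡⟨ ℤₚ.pos-* j (d (suc o)) ⟩
    + j ℤ.* + d (suc o)             ≡⟨ sym (ℤₚ.+-identityˡ _) ⟩
    0ℤ ℤ.+ + j ℤ.* + d (suc o)      ∎
    where open ≡-Reasoning
  ... | no j≮x =
    subst (λ j → gArc n x y (suc o) j ≡ + ((x + y) ∸ j) ℤ.* + d o ℤ.+ 0ℤ)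
          (ℕₚ.m+[n∸m]≡n (ℕₚ.≮⇒≥ j≮x))
          (backward (j ∸ x) (ℕₚ.m≤n+o⇒m∸n≤o j x (ℕₚ.<⇒≤ j<x+y)))
    where
      open ≡-Reasoning
      backward : ∀ t → t ≤ y → gArc n x y (suc o) (x + t) ≡ + ((x + y) ∸ (x + t)) ℤ.* + d o ℤ.+ 0ℤ
      backward t t≤y = begin
        gArc n x y (suc o) (x + t)                ≡⟨ gArc-backward o o<n t≤y ⟩
        + ((y ∸ t) * d o)                         ≡⟨ ℤₚ.pos-* (y ∸ t) (d o) ⟩
        + (y ∸ t) ℤ.* + d o                       ≡⟨ cong (λ e → + e ℤ.* + d o) (sym (ℕₚ.[m+n]∸[m+o]≡n∸o x y t)) ⟩
        + ((x + y) ∸ (x + t)) ℤ.* + d o           ≡⟨ sym (ℤₚ.+-identityʳ _) ⟩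
        + ((x + y) ∸ (x + t)) ℤ.* + d o ℤ.+ 0ℤ    ∎

  encode : ∀ {m} → ℕ → Vec (Fin (x + y)) m → Vec ℤ (m + 2)
  encode carry []       = + carry ∷ 0ℤ ∷ []
  encode carry (a ∷ as) = + (carry + backwardDigit (toℕ a)) ∷ encode (forwardDigit (toℕ a)) as

  ψ : Config n x y → Vec ℤ (n + 2)
  ψ ρ = encode 0 (rot ρ)

  arcCost : ℕ → Fin (x + y) → ℤ
  arcCost o a = gArc n x y (suc o) (toℕ a)

  letterCost : ℕ → ℤ → ℤ
  letterCost o c = c ℤ.* + d o

  sumFrom-encode : ∀ {m} o carry (v : Vec (Fin (x + y)) m) → o + m ≤ n →
    + carry ℤ.* + d o ℤ.+ sumFrom arcCost o v ≡ sumFrom letterCost o (encode carry v)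
  sumFrom-encode o carry []       _ = refl
  sumFrom-encode {suc m} o carry (a ∷ as) o+1+m≤n = begin
    + carry ℤ.* + d o ℤ.+ (arcCost o a ℤ.+ rest)
      ≡⟨ cong (λ w → + carry ℤ.* + d o ℤ.+ (w ℤ.+ rest)) (gArc≡arcWeight o o<n (Finₚ.toℕ<n a)) ⟩
    + carry ℤ.* + d o ℤ.+ (arcWeight o (toℕ a) ℤ.+ rest)
      ≡⟨ regroup (+ carry) (+ b) (+ d o) (+ f) (+ d (suc o)) rest ⟩
    + (carry + b) ℤ.* + d o ℤ.+ (+ f ℤ.* + d (suc o) ℤ.+ rest)
      ≡⟨ cong (ℤ._+_ (+ (carry + b) ℤ.* + d o)) (sumFrom-encode (suc o) f as 1+o+m≤n) ⟩
    sumFrom letterCost o (encode carry (a ∷ as)) ∎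
    where
      open ≡-Reasoning
      b = backwardDigit (toℕ a)
      f = forwardDigit (toℕ a)
      rest = sumFrom arcCost (suc o) as
      1+o+m≤n : suc o + m ≤ n
      1+o+m≤n = subst (_≤ n) (ℕₚ.+-suc o m) o+1+m≤n
      o<n : o < n
      o<n = ℕₚ.<-≤-trans (ℕₚ.m<m+n o (s≤s z≤n)) o+1+m≤n
      regroup : ∀ c b e f e′ r → c ℤ.* e ℤ.+ ((b ℤ.* e ℤ.+ f ℤ.* e′) ℤ.+ r) ≡ (c ℤ.+ b) ℤ.* e ℤ.+ (f ℤ.* e′ ℤ.+ r)
      regroup = ℤ-Solver.solve-∀

  gConf≡hE∘ψ : ∀ ρ → gConf ρ ≡ hE x y (ψ ρ)
  gConf≡hE∘ψ ρ = begin
    gConf ρ                                 ≡⟨ Σℤᶠ-lookup arcCost 0 (rot ρ) ⟩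
    sumFrom arcCost 0 (rot ρ)               ≡⟨ sym (ℤₚ.+-identityˡ _) ⟩
    0ℤ ℤ.+ sumFrom arcCost 0 (rot ρ)        ≡⟨ sumFrom-encode 0 0 (rot ρ) ℕₚ.≤-refl ⟩
    sumFrom letterCost 0 (ψ ρ)              ≡⟨ sym (Σℤᶠ-lookup letterCost 0 (ψ ρ)) ⟩
    hE x y (ψ ρ)                            ∎
    where open ≡-Reasoning

  Forward Backward : Fin (x + y) → Set
  Forward  a = toℕ a < x
  Backward a = x ≤ toℕ a

  data BackwardThenForward : ∀ {m} → Vec (Fin (x + y)) m → Set where
    forward  : ∀ {m} {as : Vec (Fin (x + y)) m} → All Forward as → BackwardThenForward as
    backward : ∀ {m a} {as : Vec (Fin (x + y)) m} →
               Backward a → BackwardThenForward as → BackwardThenForward (a ∷ as)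

  encode-∷-forward : ∀ {m c a} {as : Vec (Fin (x + y)) m} → Forward a →
                     encode c (a ∷ as) ≡ + c ∷ encode (toℕ a) as
  encode-∷-forward {c = c} fa
    rewrite backwardDigit-forward fa | forwardDigit-forward fa | ℕₚ.+-identityʳ c = refl

  encode-∷-backward : ∀ {m c a} {as : Vec (Fin (x + y)) m} → Backward a →
                      encode c (a ∷ as) ≡ + (c + ((x + y) ∸ toℕ a)) ∷ encode 0 as
  encode-∷-backward ba rewrite backwardDigit-backward ba | forwardDigit-backward ba = refl

  0<x+y∸a : ∀ (a : Fin (x + y)) → 0 < (x + y) ∸ toℕ a
  0<x+y∸a a = ℕₚ.m<n⇒0<n∸m (Finₚ.toℕ<n a)

  x+y∸a≤y : ∀ {a} → Backward a → (x + y) ∸ toℕ a ≤ y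
  x+y∸a≤y {a} ba = subst ((x + y) ∸ toℕ a ≤_) (ℕₚ.m+n∸m≡n x y) (ℕₚ.∸-monoʳ-≤ (x + y) ba)

  x+y∸-injective : ∀ {a b : Fin (x + y)} → (x + y) ∸ toℕ a ≡ (x + y) ∸ toℕ b → a ≡ b
  x+y∸-injective {a} {b} e =
    Finₚ.toℕ-injective (ℕₚ.∸-cancelˡ-≡ (ℕₚ.<⇒≤ (Finₚ.toℕ<n a)) (ℕₚ.<⇒≤ (Finₚ.toℕ<n b)) e)

  encode∈Tail : ∀ {m c} {v : Vec (Fin (x + y)) m} → c < x → All Forward v → Tail x (toList (encode c v))
  encode∈Tail c<x []         = dig (+≤+ z≤n) (+<+ c<x) end
  encode∈Tail c<x (fa ∷ fas) =
    subst (Tail x ∘ toList) (sym (encode-∷-forward fa)) (dig (+≤+ z≤n) (+<+ c<x) (encode∈Tail fa fas))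

  encode∈La : ∀ {m} {v : Vec (Fin (x + y)) m} → BackwardThenForward v → La x y (toList (encode 0 v))
  encode∈La (forward [])         = start end
  encode∈La (forward (fa ∷ fas)) =
    subst (La x y ∘ toList) (sym (encode-∷-forward fa)) (start (encode∈Tail fa fas))
  encode∈La (backward {a = a} ba bas) =
    subst (La x y ∘ toList) (sym (encode-∷-backward ba))
          (pos (+≤+ (0<x+y∸a a)) (+≤+ (x+y∸a≤y ba)) (encode∈La bas))

  encode-forward-injective : ∀ {m c c′} {v v′ : Vec (Fin (x + y)) m} → All Forward v → All Forward v′ →
                             encode c v ≡ encode c′ v′ → c ≡ c′ × v ≡ v′
  encode-forward-injective [] [] e = ℤₚ.+-injective (VP.∷-injectiveˡ e) , refl
  encode-forward-injective (fa ∷ fas) (fa′ ∷ fas′) e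
    with VP.∷-injective (trans (sym (encode-∷-forward fa)) (trans e (encode-∷-forward fa′)))
  ... | c≡c′ , e′ with encode-forward-injective fas fas′ e′
  ... | a≡a′ , as≡as′ = ℤₚ.+-injective c≡c′ , cong₂ _∷_ (Finₚ.toℕ-injective a≡a′) as≡as′

  encode-injective : ∀ {m} {v v′ : Vec (Fin (x + y)) m} → BackwardThenForward v → BackwardThenForward v′ →
                     encode 0 v ≡ encode 0 v′ → v ≡ v′
  encode-injective (forward fas) (forward fas′) e = proj₂ (encode-forward-injective fas fas′ e)
  encode-injective (backward ba bas) (backward ba′ bas′) e
    with VP.∷-injective (trans (sym (encode-∷-backward ba)) (trans e (encode-∷-backward ba′)))
  ... | k≡k′ , e′ = cong₂ _∷_ (x+y∸-injective (ℤₚ.+-injective k≡k′)) (encode-injective bas bas′ e′)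
  encode-injective (backward {a = a} ba _) (forward (fa′ ∷ _)) e =
    ⊥-elim (ℕₚ.<⇒≢ (0<x+y∸a a) (sym (ℤₚ.+-injective
      (VP.∷-injectiveˡ (trans (sym (encode-∷-backward ba)) (trans e (encode-∷-forward fa′)))))))
  encode-injective (forward (fa ∷ fas)) (backward ba′ bas′) e =
    sym (encode-injective (backward ba′ bas′) (forward (fa ∷ fas)) (sym e))

  forwardArc : ∀ {c} → c < x → Fin (x + y)
  forwardArc c<x = fromℕ< (ℕₚ.<-≤-trans c<x (ℕₚ.m≤m+n x y))

  toℕ-forwardArc : ∀ {c} (c<x : c < x) → toℕ (forwardArc c<x) ≡ c
  toℕ-forwardArc c<x = Finₚ.toℕ-fromℕ< _

  backwardArc : ∀ {k} → 0 < k → k ≤ y → Fin (x + y)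
  backwardArc {k} 0<k k≤y = fromℕ< {x + (y ∸ k)} (ℕₚ.+-monoʳ-< x (ℕₚ.∸-monoʳ-< 0<k k≤y))

  toℕ-backwardArc : ∀ {k} (0<k : 0 < k) (k≤y : k ≤ y) → toℕ (backwardArc 0<k k≤y) ≡ x + (y ∸ k)
  toℕ-backwardArc 0<k k≤y = Finₚ.toℕ-fromℕ< _

  ForwardEncoding : ∀ m → Vec ℤ (m + 2) → Set
  ForwardEncoding m w = Σ[ c ∈ ℕ ] c < x × Σ[ v ∈ Vec (Fin (x + y)) m ] All Forward v × encode c v ≡ w

  prependForward : ∀ {m w} c → ForwardEncoding m w →
                   Σ[ v ∈ Vec (Fin (x + y)) (suc m) ] All Forward v × encode c v ≡ + c ∷ w
  prependForward c (c′ , c′<x , v , fv , refl) =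
    forwardArc c′<x ∷ v , fa ∷ fv ,
    trans (encode-∷-forward fa) (cong (λ e → + c ∷ encode e v) (toℕ-forwardArc c′<x))
    where
      fa : Forward (forwardArc c′<x)
      fa = subst (_< x) (sym (toℕ-forwardArc c′<x)) c′<x

  Tail⇒ForwardEncoding : ∀ m (w : Vec ℤ (m + 2)) → Tail x (toList w) → ForwardEncoding m w
  Tail⇒ForwardEncoding zero (_ ∷ _ ∷ []) (dig (+≤+ {n = c} _) (+<+ c<x) end) = c , c<x , [] , [] , refl
  Tail⇒ForwardEncoding zero (_ ∷ _ ∷ []) (dig _ _ (dig _ _ ()))
  Tail⇒ForwardEncoding (suc zero) (_ ∷ w@(_ ∷ _ ∷ [])) (dig (+≤+ {n = c} _) (+<+ c<x) t) =
    c , c<x , prependForward c (Tail⇒ForwardEncoding zero w t)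
  Tail⇒ForwardEncoding (suc (suc m)) (_ ∷ w@(_ ∷ _)) (dig (+≤+ {n = c} _) (+<+ c<x) t) =
    c , c<x , prependForward c (Tail⇒ForwardEncoding (suc m) w t)

  La⇒encode : ∀ m (w : Vec ℤ (m + 2)) → La x y (toList w) →
              Σ[ v ∈ Vec (Fin (x + y)) m ] BackwardThenForward v × encode 0 v ≡ w
  La⇒encode zero (_ ∷ _ ∷ []) (start end)              = [] , forward [] , refl
  La⇒encode zero (_ ∷ _ ∷ []) (start (dig _ _ ()))
  La⇒encode zero (_ ∷ _ ∷ []) (pos _ _ (start ()))
  La⇒encode zero (_ ∷ _ ∷ []) (pos _ _ (pos _ _ ()))
  La⇒encode (suc m) (_ ∷ w) (start t) with prependForward 0 (Tail⇒ForwardEncoding m w t)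
  ... | v , fv , e = v , forward fv , e
  La⇒encode (suc m) (_ ∷ w) (pos (+≤+ {n = k} 0<k) (+≤+ k≤y) l) with La⇒encode m w l
  ... | v , bfv , refl = a ∷ v , backward ba bfv , trans (encode-∷-backward ba) (cong (λ i → + i ∷ encode 0 v) k≡k)
    where
      a = backwardArc 0<k k≤y
      ba : Backward a
      ba = subst (x ≤_) (sym (toℕ-backwardArc 0<k k≤y)) (ℕₚ.m≤m+n x (y ∸ k))
      k≡k : (x + y) ∸ toℕ a ≡ k
      k≡k = begin
        (x + y) ∸ toℕ a           ≡⟨ cong ((x + y) ∸_) (toℕ-backwardArc 0<k k≤y) ⟩
        (x + y) ∸ (x + (y ∸ k))   ≡⟨ ℕₚ.[m+n]∸[m+o]≡n∸o x y (y ∸ k) ⟩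
        y ∸ (y ∸ k)               ≡⟨ ℕₚ.m∸[m∸n]≡n k≤y ⟩
        k                         ∎
        where open ≡-Reasoning

  step-suc : ∀ (ρ : Config n x y) (i : Fin n) →
             step ρ (suc (toℕ i)) ≡ just (headArc x (suc (toℕ i)) (toℕ (lookup (rot ρ) i)))
  step-suc ρ i rewrite proj₂ (dec-yes (toℕ i <? n) (Finₚ.toℕ<n i)) | Finₚ.fromℕ<-toℕ i (Finₚ.toℕ<n i) = refl

  step≡just : ∀ (ρ : Config n x y) {w w′} → step ρ w ≡ just w′ →
              Σ[ i ∈ Fin n ] w ≡ suc (toℕ i) × w′ ≡ headArc x w (toℕ (lookup (rot ρ) i))
  step≡just ρ {suc k} e with k <? n
  ... | yes k<n = fromℕ< k<n , cong suc (sym (Finₚ.toℕ-fromℕ< k<n)) , sym (just-injective e)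

  Acyclic-byRanking : ∀ (ρ : Config n x y) (r : ℕ → ℕ) →
                      (∀ w w′ → step ρ w ≡ just w′ → r w′ < r w) → Acyclic ρ
  Acyclic-byRanking ρ r step-< (w , m , cycle) = ℕₚ.<-irrefl refl (iter-suc-< m cycle)
    where
      iter-≤ : ∀ m {w w′} → iter ρ m w ≡ just w′ → r w′ ≤ r w
      iter-suc-< : ∀ m {w w′} → iter ρ (suc m) w ≡ just w′ → r w′ < r w
      iter-≤ zero    refl = ℕₚ.≤-refl
      iter-≤ (suc m) e    = ℕₚ.<⇒≤ (iter-suc-< m e)
      iter-suc-< m {w} e with step ρ w in s
      ... | just u = ℕₚ.≤-<-trans (iter-≤ m e) (step-< w _ s)

  backwardCount : ∀ {m} {v : Vec (Fin (x + y)) m} → BackwardThenForward v → ℕ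
  backwardCount (forward _)     = 0
  backwardCount (backward _ bf) = suc (backwardCount bf)

  lookup-backward : ∀ {m} {v : Vec (Fin (x + y)) m} (bf : BackwardThenForward v) →
                    ∀ i → toℕ i < backwardCount bf → Backward (lookup v i)
  lookup-backward (backward ba _)  Fin.zero    _          = ba
  lookup-backward (backward _  bf) (Fin.suc i) (s≤s i<s) = lookup-backward bf i i<s

  lookup-forward : ∀ {m} {v : Vec (Fin (x + y)) m} (bf : BackwardThenForward v) →
                   ∀ i → backwardCount bf ≤ toℕ i → Forward (lookup v i)
  lookup-forward (forward fv)     i           _         = Allₚ.lookup⁺ fv i
  lookup-forward (backward _  bf) (Fin.suc i) (s≤s s≤i) = lookup-forward bf i s≤i

  -- With the rotors of u_1,…,u_s pointing down and the others up, every step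
  -- decreases the distance to the sink that is eventually reached.
  rank : ℕ → ℕ → ℕ
  rank s w with w ≤? s
  ... | yes _ = w
  ... | no  _ = suc n ∸ w

  rank-≤ : ∀ {s w} → w ≤ s → rank s w ≡ w
  rank-≤ {s} {w} w≤s rewrite proj₂ (dec-yes (w ≤? s) w≤s) = refl

  rank-> : ∀ {s w} → s < w → rank s w ≡ suc n ∸ w
  rank-> {s} {w} s<w rewrite dec-no (w ≤? s) (ℕₚ.<⇒≱ s<w) = refl

  BackwardThenForward⇒Acyclic : ∀ (ρ : Config n x y) → BackwardThenForward (rot ρ) → Acyclic ρ
  BackwardThenForward⇒Acyclic ρ bf = Acyclic-byRanking ρ (rank s) rank-decreases
    where
      open ℕₚ.≤-Reasoning
      s = backwardCount bf
      rank-decreases : ∀ w w′ → step ρ w ≡ just w′ → rank s w′ < rank s w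
      rank-decreases w w′ e with step≡just ρ {w} {w′} e
      ... | i , refl , refl with s ≤? toℕ i
      ... | no  i≱s = begin-strict
        rank s (headArc x (suc (toℕ i)) _)   ≡⟨ cong (rank s) (headArc-backward _ (lookup-backward bf i i<s)) ⟩
        rank s (toℕ i)                       ≡⟨ rank-≤ (ℕₚ.<⇒≤ i<s) ⟩
        toℕ i                                <⟨ ℕₚ.n<1+n (toℕ i) ⟩
        suc (toℕ i)                          ≡⟨ rank-≤ i<s ⟨
        rank s (suc (toℕ i))                 ∎
        where i<s = ℕₚ.≰⇒> i≱s
      ... | yes s≤i = begin-strict
        rank s (headArc x (suc (toℕ i)) _)   ≡⟨ cong (rank s) (headArc-forward _ (lookup-forward bf i s≤i)) ⟩
        rank s (suc (suc (toℕ i)))           ≡⟨ rank-> (ℕₚ.m≤n⇒m≤1+n (s≤s s≤i)) ⟩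
        suc n ∸ suc (suc (toℕ i))            <⟨ ℕₚ.∸-monoʳ-< (ℕₚ.n<1+n _) (s≤s (Finₚ.toℕ<n i)) ⟩
        suc n ∸ suc (toℕ i)                  ≡⟨ rank-> (s≤s s≤i) ⟨
        rank s (suc (toℕ i))                 ∎

  NoForwardBackward : ∀ {m} → Vec (Fin (x + y)) m → Set
  NoForwardBackward {m} v =
    ∀ (i j : Fin m) → toℕ j ≡ suc (toℕ i) → Forward (lookup v i) → ¬ Backward (lookup v j)

  Acyclic⇒NoForwardBackward : ∀ (ρ : Config n x y) → Acyclic ρ → NoForwardBackward (rot ρ)
  Acyclic⇒NoForwardBackward ρ acyclic i j j≡1+i fi bj = acyclic (suc (toℕ i) , 1 , cycle)
    where
      up : step ρ (suc (toℕ i)) ≡ just (suc (suc (toℕ i)))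
      up = trans (step-suc ρ i) (cong just (headArc-forward _ fi))
      down : step ρ (suc (suc (toℕ i))) ≡ just (suc (toℕ i))
      down = subst (λ k → step ρ (suc k) ≡ just k) j≡1+i
                   (trans (step-suc ρ j) (cong just (headArc-backward _ bj)))
      cycle : iter ρ 2 (suc (toℕ i)) ≡ just (suc (toℕ i))
      cycle rewrite up | down = refl

  NoForwardBackward-tail : ∀ {m a} {as : Vec (Fin (x + y)) m} → NoForwardBackward (a ∷ as) → NoForwardBackward as
  NoForwardBackward-tail nfb i j j≡1+i = nfb (Fin.suc i) (Fin.suc j) (cong suc j≡1+i)

  NoForwardBackward⇒AllForward : ∀ {m a} (as : Vec (Fin (x + y)) m) →
                                 Forward a → NoForwardBackward (a ∷ as) → All Forward as
  NoForwardBackward⇒AllForward []       _  _   = []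
  NoForwardBackward⇒AllForward (b ∷ bs) fa nfb with toℕ b <? x
  ... | yes fb = fb ∷ NoForwardBackward⇒AllForward bs fb (NoForwardBackward-tail nfb)
  ... | no ¬fb = ⊥-elim (nfb Fin.zero (Fin.suc Fin.zero) refl fa (ℕₚ.≮⇒≥ ¬fb))

  NoForwardBackward⇒BackwardThenForward : ∀ {m} (v : Vec (Fin (x + y)) m) →
                                          NoForwardBackward v → BackwardThenForward v
  NoForwardBackward⇒BackwardThenForward []       _   = forward []
  NoForwardBackward⇒BackwardThenForward (a ∷ as) nfb with toℕ a <? x
  ... | yes fa = forward (fa ∷ NoForwardBackward⇒AllForward as fa nfb)
  ... | no ¬fa = backward (ℕₚ.≮⇒≥ ¬fa) (NoForwardBackward⇒BackwardThenForward as (NoForwardBackward-tail nfb))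

  Acyclic⇒BackwardThenForward : ∀ (ρ : Config n x y) → Acyclic ρ → BackwardThenForward (rot ρ)
  Acyclic⇒BackwardThenForward ρ = NoForwardBackward⇒BackwardThenForward (rot ρ) ∘ Acyclic⇒NoForwardBackward ρ

lemma5 : (n x y : ℕ) → 1 ≤ n → Coprime x y → 1 ≤ x → x < y →
    Σ[ ψ ∈ (Config n x y → Vec ℤ (n + 2)) ]
    ((∀ ρ → Acyclic ρ → La x y (toList (ψ ρ)))
    × (∀ ρ ρ′ → Acyclic ρ → Acyclic ρ′ → ψ ρ ≡ ψ ρ′ → ρ ≡ ρ′)
    × (∀ c → La x y (toList c) → ∃[ ρ ] (Acyclic ρ × ψ ρ ≡ c))
    × (∀ ρ → Acyclic ρ → gConf ρ ≡ hE x y (ψ ρ)))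
lemma5 n x y _ _ _ _ = ψ , ψ∈La , ψ-injective , ψ-surjective , λ ρ _ → gConf≡hE∘ψ ρ
  where
    open PathRotors n x y

    ψ∈La : ∀ ρ → Acyclic ρ → La x y (toList (ψ ρ))
    ψ∈La ρ = encode∈La ∘ Acyclic⇒BackwardThenForward ρ

    ψ-injective : ∀ ρ ρ′ → Acyclic ρ → Acyclic ρ′ → ψ ρ ≡ ψ ρ′ → ρ ≡ ρ′
    ψ-injective ρ ρ′ acyclic acyclic′ =
      cong mkConfig ∘ encode-injective (Acyclic⇒BackwardThenForward ρ acyclic)
                                       (Acyclic⇒BackwardThenForward ρ′ acyclic′)

    ψ-surjective : ∀ c → La x y (toList c) → ∃[ ρ ] (Acyclic ρ × ψ ρ ≡ c)
    ψ-surjective c c∈La with La⇒encode n c c∈La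
    ... | v , bf , ψv≡c = mkConfig v , BackwardThenForward⇒Acyclic (mkConfig v) bf , ψv≡c
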